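{- For all positive integers $j,i,n_1,\ldots,n_i$ with $2\leq j\leq 5$, $m_j(C_3,C_3,n_1K_2,n_2K_2,\ldots,n_iK_2)=\infty$.
   Context: $K_{j\times t}$ denotes the complete multipartite graph with $j$ partite sets, each of size $t$. For graphs $H_1,\ldots,H_k$, the multipartite Ramsey number $m_j(H_1,\ldots,H_k)$ is the smallest positive integer $t$ such that for every $k$-edge-coloring $(G^1,\ldots,G^k)$ of $K_{j\times t}$ (partition of its edges into spanning subgraphs), some $G^\ell$ contains a copy of $H_\ell$; it is $\infty$ if no such $t$ exists. $C_3$ is the triangle and $nK_2$ is a matching of $n$ edges. -}

module Defs where

open import Data.Nat using (ℕ; zero; suc; _+_; _≤_)
open import Data.Fin using (Fin; zero; suc)
open import Data.Product using (Σ; _×_; _,_; proj₁)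
open import Relation.Binary.PropositionalEquality using (_≡_; _≢_)
open import Relation.Nullary using (¬_)

record Graph : Set₁ where
  field
    V : Set
    E : V → V → Set
open Graph public

C₃ : Graph
C₃ = record { V = Fin 3 ; E = λ x y → x ≢ y }

_K₂ : ℕ → Graph
n K₂ = record { V = Fin n × Fin 2 ; E = λ u v → (proj₁ u ≡ proj₁ v) × (Data.Product.proj₂ u ≢ Data.Product.proj₂ v) }

-- Vertices of K_{j×t}: (part, index in part).  u,v adjacent iff in different parts.
KV : ℕ → ℕ → Set
KV j t = Fin j × Fin t

-- A k-edge-colouring of K_{j×t}: a symmetric colour assignment on vertex pairs
-- (only its values on edges, i.e. pairs in different parts, matter).
record Colouring (k j t : ℕ) : Set where
  field
    col : KV j t → KV j t → Fin k
    sym : ∀ u v → col u v ≡ col v u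
open Colouring public

ColourClass : ∀ {k j t} → Colouring k j t → Fin k → Graph
ColourClass {k} {j} {t} c ℓ = record
  { V = KV j t
  ; E = λ u v → (proj₁ u ≢ proj₁ v) × (col c u v ≡ ℓ) }

ContainsCopy : Graph → Graph → Set
ContainsCopy G H =
  Σ (V H → V G) λ φ →
    (∀ x y → φ x ≡ φ y → x ≡ y) × (∀ x y → E H x y → E G (φ x) (φ y))

Arrows : ∀ {k} → ℕ → ℕ → (Fin k → Graph) → Set
Arrows {k} j t Hs =
  (c : Colouring k j t) → Σ (Fin k) λ ℓ → ContainsCopy (ColourClass c ℓ) (Hs ℓ)

-- m_j(H_1,…,H_k) = ∞ : no positive t satisfies the arrowing property.
RamseyInfinite : ∀ {k} → ℕ → (Fin k → Graph) → Set
RamseyInfinite j Hs = ∀ t → 1 ≤ t → ¬ Arrows j t Hs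

C3C3Matchings : ∀ i → (Fin i → ℕ) → Fin (2 + i) → Graph
C3C3Matchings i n zero = C₃
C3C3Matchings i n (suc zero) = C₃
C3C3Matchings i n (suc (suc ℓ)) = (n ℓ) K₂

-- Colour the edges of K₅ by the sides and the diagonals of a pentagon: both classes are
-- 5-cycles, so neither contains a triangle.  For j ≤ 5 give every edge of K_{j×t} the colour
-- of the pair of parts it joins.  A monochromatic triangle meets three distinct parts, hence
-- would be a monochromatic triangle of K₅; and the colours used by the matchings do not occur
-- at all, so no matching with an edge appears in them, whatever t is.

module Submission where

open import Defs hiding (sym)
open import Data.Nat using (ℕ; suc; _+_; _∸_; _≤_; s≤s)
open import Data.Nat.DivMod using (_%_)
open import Data.Fin using (Fin; zero; suc; toℕ; inject≤; _↑ˡ_)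
open import Data.Fin.Properties using (_≟_; all?; inject≤-injective; ↑ˡ-injective)
open import Data.Product using (Σ; _,_; proj₁; proj₂)
open import Function.Definitions using (Injective)
open import Relation.Binary.PropositionalEquality using (_≡_; _≢_; refl; sym; trans)
open import Relation.Nullary using (¬_; Dec)
open import Relation.Nullary.Decidable using (¬?; _→-dec_; toWitness)

HasEdge : Graph → Set
HasEdge H = Σ (V H) λ x → Σ (V H) λ y → E H x y

matching-hasEdge : ∀ {n} → 1 ≤ n → HasEdge (n K₂)
matching-hasEdge (s≤s _) = (zero , zero) , (zero , suc zero) , refl , λ ()

Symmetric : {A C : Set} → (A → A → C) → Set
Symmetric χ = ∀ a b → χ a b ≡ χ b a

NoMonochromaticTriangle : {A C : Set} → (A → A → C) → Set
NoMonochromaticTriangle χ =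
  ∀ a b c → a ≢ b → b ≢ c → a ≢ c → χ a b ≡ χ b c → χ b c ≢ χ a c

noMonochromaticTriangle? : ∀ {m k} (χ : Fin m → Fin m → Fin k) →
  Dec (NoMonochromaticTriangle χ)
noMonochromaticTriangle? χ =
  all? λ a → all? λ b → all? λ c →
    ¬? (a ≟ b) →-dec ¬? (b ≟ c) →-dec ¬? (a ≟ c) →-dec
    (χ a b ≟ χ b c) →-dec ¬? (χ b c ≟ χ a c)

symmetric? : ∀ {m k} (χ : Fin m → Fin m → Fin k) → Dec (Symmetric χ)
symmetric? χ = all? λ a → all? λ b → χ a b ≟ χ b a

module _ {A B C D : Set} (f : A → B) (g : C → D) (χ : B → B → C) where

  recolour : A → A → D
  recolour a b = g (χ (f a) (f b))

  recolour-symmetric : Symmetric χ → Symmetric recolour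
  recolour-symmetric χ-sym a b rewrite χ-sym (f a) (f b) = refl

  recolour-noMonochromaticTriangle :
    Injective _≡_ _≡_ f → Injective _≡_ _≡_ g →
    NoMonochromaticTriangle χ → NoMonochromaticTriangle recolour
  recolour-noMonochromaticTriangle f-inj g-inj none a b c a≢b b≢c a≢c ab≡bc bc≡ac =
    none (f a) (f b) (f c) (λ e → a≢b (f-inj e)) (λ e → b≢c (f-inj e))
      (λ e → a≢c (f-inj e)) (g-inj ab≡bc) (g-inj bc≡ac)

module _ {k j : ℕ} (χ : Fin j → Fin j → Fin k) (χ-sym : Symmetric χ) where

  blowUp : (t : ℕ) → Colouring k j t
  blowUp t = record
    { col = λ u v → χ (proj₁ u) (proj₁ v)
    ; sym = λ u v → χ-sym (proj₁ u) (proj₁ v)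
    }

  blowUp-noTriangle : ∀ {t} → NoMonochromaticTriangle χ →
    ∀ ℓ → ¬ ContainsCopy (ColourClass (blowUp t) ℓ) C₃
  blowUp-noTriangle none ℓ (φ , _ , adjacent)
    with adjacent zero (suc zero) (λ ())
       | adjacent (suc zero) (suc (suc zero)) (λ ())
       | adjacent zero (suc (suc zero)) (λ ())
  ... | a≢b , ab≡ℓ | b≢c , bc≡ℓ | a≢c , ac≡ℓ =
    none _ _ _ a≢b b≢c a≢c (trans ab≡ℓ (sym bc≡ℓ)) (trans bc≡ℓ (sym ac≡ℓ))

  blowUp-missingColour : ∀ {t} ℓ → (∀ a b → χ a b ≢ ℓ) →
    ∀ H → HasEdge H → ¬ ContainsCopy (ColourClass (blowUp t) ℓ) H
  blowUp-missingColour ℓ missing H (x , y , xy) (φ , _ , adjacent) =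
    missing _ _ (proj₂ (adjacent x y xy))

-- Colour 0 on the sides of the pentagon 0-1-2-3-4 (b − a ≡ ±1 mod 5), colour 1 on its diagonals.

pentagon : Fin 5 → Fin 5 → Fin 2
pentagon a b with (5 + toℕ a ∸ toℕ b) % 5
... | 1 = zero
... | 4 = zero
... | _ = suc zero

pentagon-symmetric : Symmetric pentagon
pentagon-symmetric = toWitness {a? = symmetric? pentagon} _

pentagon-noMonochromaticTriangle : NoMonochromaticTriangle pentagon
pentagon-noMonochromaticTriangle = toWitness {a? = noMonochromaticTriangle? pentagon} _

theorem5 : (j i : ℕ) → (n : Fin i → ℕ) → 2 ≤ j → j ≤ 5 → 1 ≤ i →
    (∀ ℓ → 1 ≤ n ℓ) → RamseyInfinite j (C3C3Matchings i n)
theorem5 j i n _ j≤5 _ n≥1 t _ arrows =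
  let ℓ , copy = arrows (blowUp χ χ-symmetric t) in noCopy ℓ copy
  where
  part : Fin j → Fin 5
  part a = inject≤ a j≤5

  χ : Fin j → Fin j → Fin (2 + i)
  χ = recolour part (_↑ˡ i) pentagon

  χ-symmetric : Symmetric χ
  χ-symmetric = recolour-symmetric part (_↑ˡ i) pentagon pentagon-symmetric

  χ-noMonochromaticTriangle : NoMonochromaticTriangle χ
  χ-noMonochromaticTriangle =
    recolour-noMonochromaticTriangle part (_↑ˡ i) pentagon
      (λ {a} {b} → inject≤-injective j≤5 j≤5 a b) (λ {a} {b} → ↑ˡ-injective i a b)
      pentagon-noMonochromaticTriangle

  χ-twoColours : ∀ ℓ a b → χ a b ≢ suc (suc ℓ)
  χ-twoColours ℓ a b with pentagon (part a) (part b)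
  ... | zero = λ ()
  ... | suc zero = λ ()

  noCopy : ∀ ℓ → ¬ ContainsCopy (ColourClass (blowUp χ χ-symmetric t) ℓ) (C3C3Matchings i n ℓ)
  noCopy zero = blowUp-noTriangle χ χ-symmetric χ-noMonochromaticTriangle zero
  noCopy (suc zero) = blowUp-noTriangle χ χ-symmetric χ-noMonochromaticTriangle (suc zero)
  noCopy (suc (suc ℓ)) =
    blowUp-missingColour χ χ-symmetric (suc (suc ℓ)) (χ-twoColours ℓ) (n ℓ K₂)
      (matching-hasEdge (n≥1 ℓ))
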